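{- Let $n\ge2$ and let $\Pi$ be the underlying Dyck path of an $(n-1,n)$-parking function. A cell $c\in\lambda(\Pi)$ satisfies $$\frac{\operatorname{arm}(c)}{\operatorname{leg}(c)}\le\frac{n-1}{n}<\frac{\operatorname{arm}(c)+1}{\operatorname{leg}(c)+1}$$ (with $\frac00=0$ and $\frac x0=\infty$ for $x\ne0$) if and only if its south edge and its east edge are both steps of $\Pi$, i.e. $\operatorname{arm}(c)=\operatorname{leg}(c)=0$.
   Context: An $(n-1,n)$-Dyck path is a lattice path from $(0,0)$ to $(n-1,n)$ with unit north and east steps staying weakly above the line $y=\frac{n}{n-1}x$. The unit cells of the $(n-1)\times n$ rectangle lying above $\Pi$ form a Ferrers diagram $\lambda(\Pi)$. For $c\in\lambda(\Pi)$, $\operatorname{leg}(c)$ is the number of cells of $\lambda(\Pi)$ strictly below $c$ in its column, and $\operatorname{arm}(c)$ is the number of cells of $\lambda(\Pi)$ strictly to the right of $c$ in its row. Cells satisfying the displayed inequality are called dinv corrections. By the dinv formula for $(m,n)$-parking functions with $n>m$, each such cell is subtracted from $\operatorname{tdinv}$ to give $\operatorname{dinv}$. -}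

module Defs where

open import Data.Nat using (ℕ; zero; suc; _+_; _*_; _∸_; _≤_; _<_; _<?_)
open import Data.Fin using (Fin; toℕ)
open import Data.List using (length; filter; allFin)
open import Data.Product using (_×_; Σ)
open import Data.Unit using (⊤)
open import Data.Empty using (⊥)
open import Relation.Nullary.Decidable using (_×-dec_)

-- An (m,n)-Dyck path (here m = n ∸ 1) from (0,0) to (m,n) with unit N/E steps
-- is encoded by the x-coordinates of its n north steps: the north step of
-- row y (from height y to y+1) starts at the lattice point (a y , y).
-- The path determines and is determined by this weakly increasing sequence.
-- Staying weakly above y = (n/m) x means every lattice point (x,y) of the
-- path has n*x ≤ m*y; the binding points are the bottoms of north steps.
record DyckPath (m n : ℕ) : Set where
  field
    a        : Fin n → ℕ
    mono     : ∀ (i j : Fin n) → toℕ i ≤ toℕ j → a i ≤ a j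
    aboveDiag : ∀ (y : Fin n) → n * a y ≤ m * toℕ y
open DyckPath public

-- Cells of the m×n rectangle are indexed by their lower-left corners (x , y).
-- The cell (x , y) lies above the path (i.e. belongs to λ(Π)) iff it lies to the
-- left of the north step of row y, i.e. x < a y.
Cell : ∀ {m n} → DyckPath m n → Set
Cell {n = n} Π = Σ ℕ λ x → Σ (Fin n) λ y → x < a Π y

arm : ∀ {m n} (Π : DyckPath m n) → Cell Π → ℕ
arm Π (x Data.Product., y Data.Product., _) = a Π y ∸ suc x

leg : ∀ {m n} (Π : DyckPath m n) → Cell Π → ℕ
leg {n = n} Π (x Data.Product., y Data.Product., _) =
  length (filter (λ y' → (toℕ y' <? toℕ y) ×-dec (x <? a Π y')) (allFin n))

data Ext : Set where
  frac : ℕ → ℕ → Ext   -- frac p q stands for p/q with q ≠ 0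
  ∞    : Ext

_/ₑ_ : ℕ → ℕ → Ext
zero  /ₑ zero  = frac 0 1
suc p /ₑ zero  = ∞
p     /ₑ suc q = frac p (suc q)

_≤ₑ_ : Ext → Ext → Set
frac p q ≤ₑ frac r s = p * s ≤ r * q
frac _ _ ≤ₑ ∞        = ⊤
∞        ≤ₑ frac _ _ = ⊥
∞        ≤ₑ ∞        = ⊤

_<ₑ_ : Ext → Ext → Set
frac p q <ₑ frac r s = p * s < r * q
frac _ _ <ₑ ∞        = ⊤
∞        <ₑ _        = ⊥

DinvCorrection : ∀ {n} (Π : DyckPath (n ∸ 1) n) → Cell Π → Set
DinvCorrection {n} Π c =
  ((arm Π c /ₑ leg Π c) ≤ₑ ((n ∸ 1) /ₑ n)) ×
  (((n ∸ 1) /ₑ n) <ₑ (suc (arm Π c) /ₑ suc (leg Π c)))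

module Submission where

-- Write m = n - 1, so the slope of the diagonal is m/(m+1), and
-- let a = arm(c), l = leg(c).  Unfolding the extended fractions, the two
-- inequalities of the dinv-correction condition say
--     a(m+1) ≤ m l    and    m(l+1) < (a+1)(m+1),
-- and the second one is equivalent to m l ≤ a(m+1); hence a(m+1) = m l.
-- Since m and m+1 are coprime, m divides a.  The geometry of the path enters
-- only once: the whole row of c lies left of x = m (the path stays above
-- the diagonal), so a < m, and therefore a = 0 and then l = 0.  Conversely
-- the condition is a direct computation for a = l = 0.

open import Defs
open import Data.Nat using (ℕ; _≤_; _∸_)
open import Data.Product using (_×_)
open import Function.Bundles using (_⇔_)
open import Relation.Binary.PropositionalEquality using (_≡_)

open import Data.Nat using (zero; suc; _+_; _*_; _<_; z≤n; s≤s; s≤s⁻¹; z<s; NonZero)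
open import Data.Nat.Properties
open import Data.Nat.Divisibility using (_∣_; ∣m+n∣m⇒∣n; m∣m*n; n∣m*n; ∣⇒≤)
open import Data.Fin using (Fin; toℕ)
open import Data.Fin.Properties using (toℕ<n)
open import Data.Product using (_,_)
open import Function.Bundles using (mk⇔)
open import Relation.Nullary using (contradiction)
open import Relation.Binary.PropositionalEquality using (refl; sym; trans; subst; subst₂)

/ₑ-≤ₑ-frac : ∀ a l p q → (a /ₑ l) ≤ₑ frac p (suc q) → a * suc q ≤ p * l
/ₑ-≤ₑ-frac zero    zero    p q _  = z≤n
/ₑ-≤ₑ-frac (suc a) zero    p q ()
/ₑ-≤ₑ-frac zero    (suc l) p q le = le
/ₑ-≤ₑ-frac (suc a) (suc l) p q le = le

-- The strict upper inequality m(l+1) < (a+1)(m+1) is equivalent to the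
-- non-strict m l ≤ a(m+1), because the two sides differ by m versus m+1.
strict-gap : ∀ m a l → m * suc l < suc a * suc m → m * l ≤ a * suc m
strict-gap m a l lt =
  +-cancelˡ-≤ m (m * l) (a * suc m) (s≤s⁻¹ (subst (_< suc a * suc m) (*-suc m l) lt))

-- Arithmetic core: m and m+1 are coprime, so a(m+1) = m l with 0 ≤ a < m
-- only has the trivial solution.
coprime-balance : ∀ m a l → a * suc m ≡ m * l → a < m → a ≡ 0 × l ≡ 0
coprime-balance (suc m) zero l eq _ =
  refl , *-cancelˡ-≡ l 0 (suc m) (trans (sym eq) (sym (*-zeroʳ (suc m))))
coprime-balance m (suc a) l eq a<m = contradiction (∣⇒≤ m∣a) (<⇒≱ a<m)
  where
  -- m l = (a+1)(m+1) = (a+1) m + (a+1), and m divides both m l and (a+1) m.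
  m∣a : m ∣ suc a
  m∣a = ∣m+n∣m⇒∣n
    (subst (m ∣_) (trans (sym eq) (trans (*-suc (suc a) m) (+-comm (suc a) (suc a * m))))
      (m∣m*n l))
    (n∣m*n (suc a))

correction-forces-corner : ∀ m a l → a < m →
  (a /ₑ l) ≤ₑ frac m (suc m) → m * suc l < suc a * suc m → a ≡ 0 × l ≡ 0
correction-forces-corner m a l a<m below above = coprime-balance m a l balance a<m
  where
  balance : a * suc m ≡ m * l
  balance = ≤-antisym (/ₑ-≤ₑ-frac a l m m below) (strict-gap m a l above)

corner-is-correction : ∀ m → (0 /ₑ 0) ≤ₑ frac m (suc m) × m * 1 < 1 * suc m
corner-is-correction m = z≤n , s≤s (≤-reflexive (trans (*-identityʳ m) (sym (+-identityʳ m))))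

north-step<m : ∀ {m} .{{_ : NonZero m}} (Π : DyckPath m (suc m)) (y : Fin (suc m)) →
  a Π y < m
north-step<m {m} Π y = *-cancelˡ-< (suc m) (a Π y) m (begin-strict
  suc m * a Π y  ≤⟨ aboveDiag Π y ⟩
  m * toℕ y      ≤⟨ *-monoʳ-≤ m (s≤s⁻¹ (toℕ<n y)) ⟩
  m * m          <⟨ *-monoˡ-< m (n<1+n m) ⟩
  suc m * m      ∎)
  where open ≤-Reasoning

arm<m : ∀ {m} .{{_ : NonZero m}} (Π : DyckPath m (suc m)) (c : Cell Π) → arm Π c < m
arm<m Π (x , y , x<ay) = <-≤-trans (∸-monoʳ-< z<s x<ay) (<⇒≤ (north-step<m Π y))

theorem6 : (n : ℕ) → 2 ≤ n → (Π : DyckPath (n ∸ 1) n) → (c : Cell Π) →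
    DinvCorrection Π c ⇔ (arm Π c ≡ 0 × leg Π c ≡ 0)
theorem6 (suc (suc k)) (s≤s (s≤s z≤n)) Π c = mk⇔ forward backward
  where
  forward : DinvCorrection Π c → arm Π c ≡ 0 × leg Π c ≡ 0
  forward (below , above) =
    correction-forces-corner (suc k) (arm Π c) (leg Π c) (arm<m Π c) below above
  backward : arm Π c ≡ 0 × leg Π c ≡ 0 → DinvCorrection Π c
  backward (arm≡0 , leg≡0) =
    subst₂ (λ α ℓ → (α /ₑ ℓ) ≤ₑ frac (suc k) (suc (suc k)) × suc k * suc ℓ < suc α * suc (suc k))
      (sym arm≡0) (sym leg≡0) (corner-is-correction (suc k))
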